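{- Let $k\ge2$, $1\le i\le k$, and $s,t,n\ge0$. There is a bijection between the generalized Bressoud–Burge lattice paths of major index $n$ satisfying the odd $(k,i)$-conditions with $s$ peaks marked by $a$ and $t$ peaks marked by $b$, and the Frobenius representations of overpartition pairs of $n$ with $s$ non-overlined parts in the bottom row and $t$ non-overlined parts in the top row all of whose successive ranks lie in $[-i+2,2k-i-1]$; moreover, under this bijection a path has $N$ peaks if and only if the corresponding Frobenius representation has $N$ columns.
   Context: Overpartition: a partition in which the first occurrence of each part size may be overlined. Frobenius representation of an overpartition pair of $n$: a two-rowed array $\begin{pmatrix}a_1&\cdots&a_N\\ b_1&\cdots&b_N\end{pmatrix}$ whose rows are overpartitions into $N$ nonnegative parts (0 may be a part and may be overlined) with $N+\sum_j(a_j+b_j)=n$. Its $j$-th successive rank is $a_j-b_j$ minus the number of non-overlined parts among $b_{j+1},\dots,b_N$ plus the number of non-overlined parts among $a_{j+1},\dots,a_N$. Generalized Bressoud–Burge lattice paths: paths in the first quadrant starting on the $y$-axis and ending on the $x$-axis, with steps NE $(x,y)\to(x+1,y+1)$, SE $(x,y)\to(x+1,y-1)$, S $(x,y)\to(x,y-1)$, SW $(x,y)\to(x-1,y-1)$, E $(x,0)\to(x+1,0)$ (only at height 0), where S and SW steps may only occur immediately after an NE step (the path ends at its first arrival on the $x$-axis after its last peak, or at its first arrival on the $x$-axis if it has no peak). A peak is a vertex preceded by NE and followed by S (labelled $a$ or $b$: $a$-peak or $b$-peak), by SW ($ab$-peak), or by SE ($1$-peak). Marked by $a$: $a$- and $ab$-peaks;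 marked by $b$: $b$- and $ab$-peaks. Major index: sum of the $x$-coordinates of the peaks. Odd $(k,i)$-conditions: start at $(0,k-i)$ and height always $<k$. -}

module Defs where

open import Data.Bool using (Bool; true; false)
open import Data.Nat using (ℕ; zero; suc; _+_; _*_; _∸_; _≤_; _<_)
open import Data.Integer as ℤ using (ℤ; +_)
open import Data.List using (List; []; _∷_; _++_; length; map)
open import Data.Nat.ListAction using (sum)
open import Data.List.Relation.Unary.All using (All)
open import Data.Product using (Σ; _×_; _,_; proj₁; proj₂)
open import Data.Unit using (⊤)
open import Relation.Binary.PropositionalEquality using (_≡_)

data AB : Set where
  a b : AB

-- steps: NE (x+1,y+1), SE (x+1,y-1), S (x,y-1) carrying the label (a or b)
-- of the peak it follows, SW (x-1,y-1), E (x+1,0) (only at height 0)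
data Step : Set where
  NE SE SW E : Step
  S : AB → Step

-- effect of a step on the x-coordinate (only used on valid paths)
moveX : ℕ → Step → ℕ
moveX x NE = suc x
moveX x SE = suc x
moveX x E = suc x
moveX x (S _) = x
moveX x SW = x ∸ 1

moveY : ℕ → Step → ℕ
moveY y NE = suc y
moveY y SE = y ∸ 1
moveY y E = y
moveY y (S _) = y ∸ 1
moveY y SW = y ∸ 1

isNE : Step → Bool
isNE NE = true
isNE _ = false

peakHere : ℕ → Step → List Step → List (ℕ × Step)
peakHere x NE (S l ∷ _) = (suc x , S l) ∷ []
peakHere x NE (SW ∷ _) = (suc x , SW) ∷ []
peakHere x NE (SE ∷ _) = (suc x , SE) ∷ []
peakHere _ _ _ = []

-- all peaks of the path (starting at x-coordinate x), in order,
-- with x-coordinate and the step following the peak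
peakList : ℕ → List Step → List (ℕ × Step)
peakList x [] = []
peakList x (s ∷ ss) = peakHere x s ss ++ peakList (moveX x s) ss

peaks : List Step → List (ℕ × Step)
peaks = peakList 0

numPeaks : List Step → ℕ
numPeaks ss = length (peaks ss)

majorIndex : List Step → ℕ
majorIndex ss = sum (map proj₁ (peaks ss))

-- marked by a: a-peaks and ab-peaks; marked by b: b-peaks and ab-peaks
markA : Step → ℕ
markA (S a) = 1
markA SW = 1
markA _ = 0

markB : Step → ℕ
markB (S b) = 1
markB SW = 1
markB _ = 0

markedA : List Step → ℕ
markedA ss = sum (map (λ p → markA (proj₂ p)) (peaks ss))

markedB : List Step → ℕ
markedB ss = sum (map (λ p → markB (proj₂ p)) (peaks ss))

HasPeak : List Step → Set
HasPeak ss = 0 < numPeaks ss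

-- a vertex at height 0 may only be non-final if a peak follows it
-- (so the path ends at its first arrival on the x-axis after its last
-- peak, or at its first arrival on the x-axis if it has no peak)
MayContinue : ℕ → List Step → Set
MayContinue zero ss = HasPeak ss
MayContinue (suc _) ss = ⊤

-- admissibility of a step from vertex (x,y); prevNE records whether the
-- previous step was NE.  Staying in the first quadrant is enforced here.
StepOK : ℕ → ℕ → Bool → Step → Set
StepOK x y prevNE NE = ⊤
StepOK x y prevNE SE = 1 ≤ y
StepOK x y prevNE (S _) = prevNE ≡ true × 1 ≤ y
StepOK x y prevNE SW = prevNE ≡ true × 1 ≤ y × 1 ≤ x
StepOK x y prevNE E = y ≡ 0

ValidFrom : (k x y : ℕ) → Bool → List Step → Set
ValidFrom k x y prevNE [] = y < k × y ≡ 0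
ValidFrom k x y prevNE (s ∷ ss) =
  y < k × StepOK x y prevNE s × MayContinue y (s ∷ ss) ×
  ValidFrom k (moveX x s) (moveY y s) (isNE s) ss

-- generalized Bressoud–Burge paths satisfying the odd (k,i)-conditions
-- (start at (0,k-i), height always < k) with major index n,
-- s peaks marked by a and t peaks marked by b
BBPath : (k i s t n : ℕ) → Set
BBPath k i s t n = Σ (List Step) λ ss →
  ValidFrom k 0 (k ∸ i) false ss × majorIndex ss ≡ n ×
  markedA ss ≡ s × markedB ss ≡ t

-- a part of an overpartition: value and whether it is overlined
OvPart : Set
OvPart = ℕ × Bool

-- q may follow p in a (non-increasing) overpartition: an overlined part is
-- the first occurrence of its size
Follows : OvPart → OvPart → Set
Follows (p , _) (q , true) = q < p
Follows (p , _) (q , false) = q ≤ p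

IsOverpartition : List OvPart → Set
IsOverpartition [] = ⊤
IsOverpartition (p ∷ []) = ⊤
IsOverpartition (p ∷ q ∷ ps) = Follows p q × IsOverpartition (q ∷ ps)

nonOv : OvPart → ℕ
nonOv (_ , true) = 0
nonOv (_ , false) = 1

countNonOv : List OvPart → ℕ
countNonOv ps = sum (map nonOv ps)

-- a two-rowed array given as list of columns (a_j , b_j)
Array : Set
Array = List (OvPart × OvPart)

top bottom : Array → List OvPart
top = map proj₁
bottom = map proj₂

columns : Array → ℕ
columns = length

weight : Array → ℕ
weight cs = length cs + sum (map (λ c → proj₁ (proj₁ c) + proj₁ (proj₂ c)) cs)

successiveRanks : Array → List ℤ
successiveRanks [] = []
successiveRanks (((x , _) , (y , _)) ∷ cs) =
  ((+ x ℤ.- + y) ℤ.- + countNonOv (bottom cs) ℤ.+ + countNonOv (top cs))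
    ∷ successiveRanks cs

FrobRep : (k i s t n : ℕ) → Set
FrobRep k i s t n = Σ Array λ cs →
  IsOverpartition (top cs) × IsOverpartition (bottom cs) ×
  weight cs ≡ n ×
  countNonOv (bottom cs) ≡ s × countNonOv (top cs) ≡ t ×
  All (λ r → (+ 2 ℤ.- + i) ℤ.≤ r × r ℤ.≤ (+ (2 * k) ℤ.- + i ℤ.- + 1))
      (successiveRanks cs)

module Submission where

-- Cut the path at its peaks.  Between two peaks it runs SE^p E^q NE^(r+1) and then
-- leaves the peak by SE, S or SW; the kind of peak decides which of the two entries of
-- the corresponding column are overlined.  At a given starting height y the admissible
-- triples (p , q , r) are coded bijectively by pairs (u , v) of naturals, and the parity
-- of q toggles an orientation.  Reading the peaks from the last one back, each column is
-- (a , b) = (u , v) (or (v , u), according to the orientation) plus the least values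
-- allowed above the previous column, so both rows are overpartitions automatically.
-- The x-coordinate of a peak is a + b + 1 for its column, so weight equals major index,
-- and the successive rank of the column is d - y or d + 1 + y (d = k - i the starting
-- height, y the height after the peak), so the rank window is the height condition.

open import Defs
open import Axiom.UniquenessOfIdentityProofs.WithK using (uip)
open import Data.Bool using (Bool; true; false)
open import Data.Nat using (ℕ; zero; suc; _+_; _*_; _∸_; _≤_; _<_; z≤n; s≤s; _≤?_)
open import Data.Nat.Properties
open import Algebra.Properties.CommutativeSemigroup +-commutativeSemigroup using (interchange; xy∙z≈xz∙y; x∙yz≈y∙xz)
open import Data.List using (List; []; _∷_; _++_; length; map; replicate; reverse)
open import Data.Nat.ListAction using (sum)
open import Data.Nat.ListAction.Properties using (sum-++)
import Data.List.Properties as List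
open import Data.Nat.Base using (parity)
open import Data.Parity.Base as ℙ using (Parity; 0ℙ; 1ℙ)
open import Data.List.Relation.Unary.All as All using (All)
open import Data.Product using (Σ; _×_; _,_; proj₁; proj₂; map₂)
open import Data.Sum as Sum using (_⊎_; inj₁; inj₂)
open import Function using (_∘_; _⇔_; mk⇔; Equivalence)
open import Function.Bundles using (_⤖_; Bijection; mk↔ₛ′)
open import Function.Properties.Inverse using (↔⇒⤖)
open import Data.Integer as ℤ using (ℤ; _⊖_)
import Data.Integer.Properties as ℤₚ
import Data.Integer.Tactic.RingSolver as ℤSolver
open import Data.Nat.Tactic.RingSolver using (solve)
open import Data.Unit using (⊤; tt)
open import Data.Empty using (⊥; ⊥-elim)
open import Relation.Nullary using (¬_; yes; no; contradiction)
open import Relation.Binary.PropositionalEquality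

-- A peak's label says which parts of its column are overlined: (top , bottom).
Label : Set
Label = Bool × Bool

descent : Label → Step
descent (true , true) = SE
descent (true , false) = S a
descent (false , true) = S b
descent (false , false) = SW

labelOf : Step → Label
labelOf (S a) = true , false
labelOf (S b) = false , true
labelOf SW = false , false
labelOf _ = true , true

labelOf-descent : ∀ τ → labelOf (descent τ) ≡ τ
labelOf-descent (true , true) = refl
labelOf-descent (true , false) = refl
labelOf-descent (false , true) = refl
labelOf-descent (false , false) = refl

descent-injective : ∀ {τ σ} → descent τ ≡ descent σ → τ ≡ σ
descent-injective {τ} {σ} eq =
  trans (sym (labelOf-descent τ)) (trans (cong labelOf eq) (labelOf-descent σ))

-- The block  SE^fall E^flat NE^(1+rise) (descent label)  from one peak to the next.
record Block : Set where
  constructor block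
  field
    label : Label
    fall flat rise : ℕ

data FlatsOnAxis (y fall : ℕ) : ℕ → Set where
  no-flats : FlatsOnAxis y fall 0
  flats    : ∀ {q} → fall ≡ y → FlatsOnAxis y fall (suc q)

heightAfter : ℕ → Block → ℕ
heightAfter y (block τ p q r) = r + (y ∸ p)

BlockOK : ℕ → ℕ → Block → Set
BlockOK k y (block τ p q r) = p ≤ y × FlatsOnAxis y p q × suc (r + (y ∸ p)) < k

Blocks : ℕ → ℕ → List Block → Set
Blocks k y [] = ⊤
Blocks k y (c ∷ L) = BlockOK k y c × Blocks k (heightAfter y c) L

SEs Es NEs : ℕ → List Step
SEs n = replicate n SE
Es n = replicate n E
NEs n = replicate n NE

render : ℕ → List Block → List Step
render y [] = SEs y
render y (block τ p q r ∷ L) =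
  SEs p ++ Es q ++ NE ∷ NEs r ++ descent τ ∷ render (r + (y ∸ p)) L

peakX : Block → ℕ → ℕ
peakX (block τ p q r) x = suc (r + (q + (p + x)))

xAfter : Block → ℕ → ℕ
xAfter c x = moveX (peakX c x) (descent (Block.label c))

blockPeaks : ℕ → List Block → List (ℕ × Step)
blockPeaks x [] = []
blockPeaks x (c ∷ L) = (peakX c x , descent (Block.label c)) ∷ blockPeaks (xAfter c x) L

length-blockPeaks : ∀ x L → length (blockPeaks x L) ≡ length L
length-blockPeaks x [] = refl
length-blockPeaks x (c ∷ L) = cong suc (length-blockPeaks _ L)

peakList-SEs : ∀ x n R → peakList x (SEs n ++ R) ≡ peakList (n + x) R
peakList-SEs x zero R = refl
peakList-SEs x (suc n) R = trans (peakList-SEs (suc x) n R) (cong (λ z → peakList z R) (+-suc n x))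

peakList-Es : ∀ x n R → peakList x (Es n ++ R) ≡ peakList (n + x) R
peakList-Es x zero R = refl
peakList-Es x (suc n) R = trans (peakList-Es (suc x) n R) (cong (λ z → peakList z R) (+-suc n x))

peakList-descent : ∀ x τ R → peakList x (descent τ ∷ R) ≡ peakList (moveX x (descent τ)) R
peakList-descent x (true , true) R = refl
peakList-descent x (true , false) R = refl
peakList-descent x (false , true) R = refl
peakList-descent x (false , false) R = refl

peakHere-descent : ∀ x τ R → peakHere x NE (descent τ ∷ R) ≡ (suc x , descent τ) ∷ []
peakHere-descent x (true , true) R = refl
peakHere-descent x (true , false) R = refl
peakHere-descent x (false , true) R = refl
peakHere-descent x (false , false) R = refl

peakList-rise : ∀ x r τ R → peakList x (NE ∷ NEs r ++ descent τ ∷ R) ≡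
  (suc (r + x) , descent τ) ∷ peakList (moveX (suc (r + x)) (descent τ)) R
peakList-rise x zero τ R =
  cong₂ _++_ (peakHere-descent x τ R) (peakList-descent (suc x) τ R)
peakList-rise x (suc r) τ R = trans (peakList-rise (suc x) r τ R)
  (cong (λ z → (suc z , descent τ) ∷ peakList (moveX (suc z) (descent τ)) R) (+-suc r x))

peakList-render : ∀ x y L → peakList x (render y L) ≡ blockPeaks x L
peakList-render x y [] = trans (cong (peakList x) (sym (List.++-identityʳ (SEs y)))) (peakList-SEs x y [])
peakList-render x y (block τ p q r ∷ L) =
  trans (peakList-SEs x p _) (trans (peakList-Es (p + x) q _)
    (trans (peakList-rise (q + (p + x)) r τ _) (cong (_ ∷_) (peakList-render _ _ L))))

hasPeak-block : ∀ q r τ R → HasPeak (Es q ++ NE ∷ NEs r ++ descent τ ∷ R)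
hasPeak-block q r τ R = subst (λ ps → 0 < length ps)
  (sym (trans (peakList-Es 0 q _) (peakList-rise (q + 0) r τ R))) (s≤s z≤n)

-- Valid paths are exactly the rendered block lists

module _ {k : ℕ} where

  valid-SEs : ∀ n {y} rest → n ≤ y → y < k → (∀ x → ValidFrom k x (y ∸ n) false rest) →
              ∀ x → ValidFrom k x y false (SEs n ++ rest)
  valid-SEs zero rest _ _ h x = h x
  valid-SEs (suc n) {suc y} rest (s≤s n≤y) y<k h x =
    y<k , s≤s z≤n , tt , valid-SEs n rest n≤y (≤-trans (n≤1+n (suc y)) y<k) h (suc x)

  valid-Es : ∀ n r τ R {h} → h ≡ 0 → h < k → (∀ x → ValidFrom k x h false (NE ∷ NEs r ++ descent τ ∷ R)) →
             ∀ x → ValidFrom k x h false (Es n ++ NE ∷ NEs r ++ descent τ ∷ R)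
  valid-Es zero r τ R _ _ v x = v x
  valid-Es (suc n) r τ R h≡0 h<k v x =
    h<k , h≡0 , subst (λ h → MayContinue h _) (sym h≡0) (hasPeak-block (suc n) r τ R) ,
    valid-Es n r τ R h≡0 h<k v (suc x)

  valid-descent : ∀ τ {x y} rest → suc y < k → ValidFrom k (moveX (suc x) (descent τ)) y false rest →
                  ValidFrom k (suc x) (suc y) true (descent τ ∷ rest)
  valid-descent (true , true) rest lt h = lt , s≤s z≤n , tt , h
  valid-descent (true , false) rest lt h = lt , (refl , s≤s z≤n) , tt , h
  valid-descent (false , true) rest lt h = lt , (refl , s≤s z≤n) , tt , h
  valid-descent (false , false) rest lt h = lt , (refl , s≤s z≤n , s≤s z≤n) , tt , h

  valid-rise : ∀ r τ {y} rest → suc (r + y) < k → (∀ x → ValidFrom k x (r + y) false rest) →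
               ∀ x → ValidFrom k (suc x) (suc y) true (NEs r ++ descent τ ∷ rest)
  valid-rise zero τ rest lt h x = valid-descent τ rest lt (h _)
  valid-rise (suc r) τ {y} rest lt h x =
    ≤-trans (s≤s (s≤s (m≤n+m y r))) (<⇒≤ lt) , tt , tt ,
    valid-rise r τ rest (subst (λ z → suc z < k) (sym (+-suc r y)) lt)
      (λ x → subst (λ z → ValidFrom k x z false rest) (sym (+-suc r y)) (h x)) (suc x)

  valid-peak : ∀ r τ y rest → suc (r + y) < k → (∀ x → ValidFrom k x (r + y) false rest) →
               ∀ x → ValidFrom k x y false (NE ∷ NEs r ++ descent τ ∷ rest)
  valid-peak r τ y rest lt h x = ≤-trans (s≤s (m≤n+m y r)) (<⇒≤ lt) , tt , mayContinue y , valid-rise r τ rest lt h x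
    where
      mayContinue : ∀ y → MayContinue y (NE ∷ NEs r ++ descent τ ∷ rest)
      mayContinue zero = hasPeak-block 0 r τ rest
      mayContinue (suc y) = tt

  render-valid : ∀ y L → y < k → Blocks k y L → ∀ x → ValidFrom k x y false (render y L)
  render-valid y [] y<k tt x = subst (ValidFrom k x y false) (List.++-identityʳ (SEs y))
    (valid-SEs y [] ≤-refl y<k (λ _ → ≤-<-trans (m∸n≤m y y) y<k , n∸n≡0 y) x)
  render-valid y (block τ p q r ∷ L) y<k ((p≤y , flatsOK , lt) , ok) x =
    valid-SEs p _ p≤y y<k (afterFall q flatsOK) x
    where
      peak : ∀ x → ValidFrom k x (y ∸ p) false (NE ∷ NEs r ++ descent τ ∷ render (r + (y ∸ p)) L)
      peak = valid-peak r τ (y ∸ p) _ lt (render-valid (r + (y ∸ p)) L (<⇒≤ lt) ok)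
      afterFall : ∀ q → FlatsOnAxis y p q →
                  ∀ x → ValidFrom k x (y ∸ p) false (Es q ++ NE ∷ NEs r ++ descent τ ∷ render (r + (y ∸ p)) L)
      afterFall zero no-flats x = peak x
      afterFall (suc q) (flats refl) = valid-Es (suc q) r τ _ (n∸n≡0 y) (≤-<-trans (m∸n≤m y y) y<k) peak

  Parsed : ℕ → List Step → Set
  Parsed y ss = Σ (List Block) λ L → Blocks k y L × render y L ≡ ss

  -- what remains of a block after its first NE step, taken from height y
  Rising : ℕ → List Step → Set
  Rising y ss = Σ ℕ λ r → Σ Label λ τ → Σ (List Block) λ L →
    suc (r + y) < k × Blocks k (r + y) L × NEs r ++ descent τ ∷ render (r + y) L ≡ ss

  parsed-NE : ∀ {y ss} → Rising y ss → Parsed y (NE ∷ ss)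
  parsed-NE (r , τ , L , lt , ok , eq) = block τ 0 0 r ∷ L , ((z≤n , no-flats , lt) , ok) , cong (NE ∷_) eq

  parsed-SE : ∀ {y ss} → Parsed y ss → Parsed (suc y) (SE ∷ ss)
  parsed-SE ([] , tt , eq) = [] , tt , cong (SE ∷_) eq
  parsed-SE {y} (block τ p q r ∷ L , ((p≤y , flatsOK , lt) , ok) , eq) =
    block τ (suc p) q r ∷ L , ((s≤s p≤y , shift flatsOK , lt) , ok) , cong (SE ∷_) eq
    where
      shift : ∀ {q} → FlatsOnAxis y p q → FlatsOnAxis (suc y) (suc p) q
      shift no-flats = no-flats
      shift (flats p≡y) = flats (cong suc p≡y)

  parsed-E : ∀ {ss} → HasPeak (E ∷ ss) → Parsed 0 ss → Parsed 0 (E ∷ ss)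
  parsed-E () ([] , tt , refl)
  parsed-E _ (block τ .0 q r ∷ L , ((z≤n , _ , lt) , ok) , eq) =
    block τ 0 (suc q) r ∷ L , ((z≤n , flats refl , lt) , ok) , cong (E ∷_) eq

  rising-descent : ∀ τ {y ss} → suc y < k → Parsed y ss → Rising y (descent τ ∷ ss)
  rising-descent τ lt (L , ok , eq) = 0 , τ , L , lt , ok , cong (descent τ ∷_) eq

  rising-NE : ∀ {y ss} → Rising (suc y) ss → Rising y (NE ∷ ss)
  rising-NE {y} {ss} (r , τ , L , lt , ok , eq) = suc r , τ , L ,
    subst (λ h → suc h < k × Blocks k h L × NEs (suc r) ++ descent τ ∷ render h L ≡ NE ∷ ss)
      (+-suc r y) (lt , ok , cong (NE ∷_) eq)

  mutual
    parse : ∀ x y ss → ValidFrom k x y false ss → Parsed y ss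
    parse x y [] (_ , refl) = [] , tt , refl
    parse x y (NE ∷ ss) (_ , _ , _ , v) = parsed-NE (parseRising (suc x) y ss v)
    parse x (suc y) (SE ∷ ss) (_ , _ , _ , v) = parsed-SE (parse (suc x) y ss v)
    parse x .0 (E ∷ ss) (_ , refl , hp , v) = parsed-E hp (parse (suc x) 0 ss v)
    parse x y (S l ∷ ss) (_ , (() , _) , _)
    parse x y (SW ∷ ss) (_ , (() , _) , _)

    parseRising : ∀ x y ss → ValidFrom k x (suc y) true ss → Rising y ss
    parseRising x y (NE ∷ ss) (_ , _ , _ , v) = rising-NE (parseRising (suc x) (suc y) ss v)
    parseRising x y (SE ∷ ss) (lt , _ , _ , v) = rising-descent (true , true) lt (parse (suc x) y ss v)
    parseRising x y (S a ∷ ss) (lt , _ , _ , v) = rising-descent (true , false) lt (parse x y ss v)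
    parseRising x y (S b ∷ ss) (lt , _ , _ , v) = rising-descent (false , true) lt (parse x y ss v)
    parseRising x y (SW ∷ ss) (lt , _ , _ , v) = rising-descent (false , false) lt (parse (x ∸ 1) y ss v)
    parseRising x y (E ∷ ss) (_ , () , _)

StartsWith : Step → List Step → Set
StartsWith c [] = ⊥
StartsWith c (s ∷ _) = s ≡ c

replicate-++-injective : ∀ c m n {X Y} → ¬ StartsWith c X → ¬ StartsWith c Y →
  replicate m c ++ X ≡ replicate n c ++ Y → m ≡ n × X ≡ Y
replicate-++-injective c zero zero _ _ eq = refl , eq
replicate-++-injective c zero (suc n) ¬X _ refl = ⊥-elim (¬X refl)
replicate-++-injective c (suc m) zero _ ¬Y refl = ⊥-elim (¬Y refl)
replicate-++-injective c (suc m) (suc n) ¬X ¬Y eq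
  with replicate-++-injective c m n ¬X ¬Y (List.∷-injectiveʳ eq)
... | refl , eq′ = refl , eq′

block-¬SE : ∀ q {Y} → ¬ StartsWith SE (Es q ++ NE ∷ Y)
block-¬SE zero ()
block-¬SE (suc q) ()

block-nonempty : ∀ q {Y} → ¬ ([] ≡ Es q ++ NE ∷ Y)
block-nonempty zero ()
block-nonempty (suc q) ()

descent-≢NE : ∀ τ → descent τ ≢ NE
descent-≢NE (true , true) ()
descent-≢NE (true , false) ()
descent-≢NE (false , true) ()
descent-≢NE (false , false) ()

render-injective : ∀ y L M → render y L ≡ render y M → L ≡ M
render-injective y [] [] eq = refl
render-injective y [] (block τ p q r ∷ M) eq =
  ⊥-elim (block-nonempty q (proj₂ (replicate-++-injective SE y p (λ ()) (block-¬SE q)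
    (trans (List.++-identityʳ (SEs y)) eq))))
render-injective y (block τ p q r ∷ L) [] eq =
  ⊥-elim (block-nonempty q (proj₂ (replicate-++-injective SE y p (λ ()) (block-¬SE q)
    (trans (List.++-identityʳ (SEs y)) (sym eq)))))
render-injective y (block τ p q r ∷ L) (block σ p′ q′ r′ ∷ M) eq
  with replicate-++-injective SE p p′ (block-¬SE q) (block-¬SE q′) eq
... | refl , eq₁ with replicate-++-injective E q q′ (λ ()) (λ ()) eq₁
... | refl , eq₂ with replicate-++-injective NE r r′ (descent-≢NE τ) (descent-≢NE σ) (List.∷-injectiveʳ eq₂)
... | refl , eq₃ with descent-injective (List.∷-injectiveˡ eq₃)
... | refl = cong (_ ∷_) (render-injective _ L M (List.∷-injectiveʳ eq₃))

finalHeight : ℕ → List Block → ℕ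
finalHeight y [] = y
finalHeight y (c ∷ L) = finalHeight (heightAfter y c) L

finalX : ℕ → List Block → ℕ
finalX x [] = x
finalX x (c ∷ L) = finalX (xAfter c x) L

Blocks-++⁻ : ∀ {k} y L M → Blocks k y (L ++ M) → Blocks k y L × Blocks k (finalHeight y L) M
Blocks-++⁻ y [] M ok = tt , ok
Blocks-++⁻ y (c ∷ L) M (okc , ok) = let (okL , okM) = Blocks-++⁻ (heightAfter y c) L M ok in (okc , okL) , okM

Blocks-++⁺ : ∀ {k} y L M → Blocks k y L → Blocks k (finalHeight y L) M → Blocks k y (L ++ M)
Blocks-++⁺ y [] M tt ok = ok
Blocks-++⁺ y (c ∷ L) M (okc , okL) okM = okc , Blocks-++⁺ (heightAfter y c) L M okL okM

finalHeight-++ : ∀ y L M → finalHeight y (L ++ M) ≡ finalHeight (finalHeight y L) M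
finalHeight-++ y [] M = refl
finalHeight-++ y (c ∷ L) M = finalHeight-++ (heightAfter y c) L M

finalX-++ : ∀ x L M → finalX x (L ++ M) ≡ finalX (finalX x L) M
finalX-++ x [] M = refl
finalX-++ x (c ∷ L) M = finalX-++ (xAfter c x) L M

blockPeaks-++ : ∀ x L M → blockPeaks x (L ++ M) ≡ blockPeaks x L ++ blockPeaks (finalX x L) M
blockPeaks-++ x [] M = refl
blockPeaks-++ x (c ∷ L) M = cong (_ ∷_) (blockPeaks-++ (xAfter c x) L M)

-- Coding a block by two free parameters

record Code : Set where
  constructor code
  field
    label : Label
    u v : ℕ

-- (u , v) for a block with fall p, flats q and rise r starting at height y; v ≤ y iff q = 0.
coords : ℕ → ℕ → ℕ → ℕ → ℕ × ℕ
coords y p zero r = r , p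
coords y p (suc zero) r = 0 , r + suc y
coords y p (suc (suc q)) r = suc (proj₁ (coords y p q r)) , suc (proj₂ (coords y p q r))

-- (flats , rise) of a block with fall y and v = t + suc y.
flatsRise : ℕ → ℕ → ℕ × ℕ
flatsRise zero t = 1 , t
flatsRise (suc u) zero = 2 , u
flatsRise (suc u) (suc t) = suc (suc (proj₁ (flatsRise u t))) , proj₂ (flatsRise u t)

encode : ℕ → Block → Code
encode y (block τ p q r) = code τ (proj₁ (coords y p q r)) (proj₂ (coords y p q r))

decode : ℕ → Code → Block
decode y (code τ u v) with v ≤? y
... | yes _ = block τ v 0 u
... | no _ = block τ y (proj₁ (flatsRise u (v ∸ suc y))) (proj₂ (flatsRise u (v ∸ suc y)))

coords-flatsRise : ∀ y u t → coords y y (proj₁ (flatsRise u t)) (proj₂ (flatsRise u t)) ≡ (u , t + suc y)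
coords-flatsRise y zero t = refl
coords-flatsRise y (suc u) zero = refl
coords-flatsRise y (suc u) (suc t) = cong (λ (u , v) → suc u , suc v) (coords-flatsRise y u t)

encode-decode : ∀ y w → encode y (decode y w) ≡ w
encode-decode y (code τ u v) with v ≤? y
... | yes _ = refl
... | no v≰y = cong₂ (code τ) (cong proj₁ (coords-flatsRise y u (v ∸ suc y)))
  (trans (cong proj₂ (coords-flatsRise y u (v ∸ suc y))) (m∸n+n≡m (≰⇒> v≰y)))

flatsRise-coords : ∀ y q r → Σ ℕ λ t → proj₂ (coords y y (suc q) r) ≡ t + suc y ×
                   flatsRise (proj₁ (coords y y (suc q) r)) t ≡ (suc q , r)
flatsRise-coords y zero r = r , refl , refl
flatsRise-coords y (suc zero) r = 0 , refl , refl
flatsRise-coords y (suc (suc q)) r with flatsRise-coords y q r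
... | t , eq₁ , eq₂ = suc t , cong suc eq₁ , cong (λ (q , r) → suc (suc q) , r) eq₂

decode-encode : ∀ y c → Block.fall c ≤ y → FlatsOnAxis y (Block.fall c) (Block.flat c) →
                decode y (encode y c) ≡ c
decode-encode y (block τ p zero r) p≤y no-flats with p ≤? y
... | yes _ = refl
... | no p≰y = contradiction p≤y p≰y
decode-encode y (block τ .y (suc q) r) _ (flats refl) with flatsRise-coords y q r
... | t , v≡ , flatsRise≡ with proj₂ (coords y y (suc q) r) ≤? y
...   | yes v≤y = contradiction (subst (y <_) (sym v≡) (m≤n+m (suc y) t)) (≤⇒≯ v≤y)
...   | no _ = cong (λ (q , r) → block τ y q r)
  (trans (cong (flatsRise _) (trans (cong (_∸ suc y) v≡) (m+n∸n≡m t (suc y)))) flatsRise≡)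

flatsRise-flats : ∀ y u t → FlatsOnAxis y y (proj₁ (flatsRise u t))
flatsRise-flats y zero t = flats refl
flatsRise-flats y (suc u) zero = flats refl
flatsRise-flats y (suc u) (suc t) = flats refl

flatsRise-size : ∀ u t → proj₂ (flatsRise u t) + proj₁ (flatsRise u t) ≡ suc (u + t)
flatsRise-size zero t = +-comm t 1
flatsRise-size (suc u) zero = trans (+-comm u 2) (cong (suc ∘ suc) (sym (+-identityʳ u)))
flatsRise-size (suc u) (suc t) = begin
  r + suc (suc q)    ≡⟨ +-suc r (suc q) ⟩
  suc (r + suc q)    ≡⟨ cong suc (+-suc r q) ⟩
  suc (suc (r + q))  ≡⟨ cong (suc ∘ suc) (flatsRise-size u t) ⟩
  suc (suc (suc (u + t)))  ≡⟨ cong (suc ∘ suc) (sym (+-suc u t)) ⟩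
  suc (suc u + suc t)  ∎
  where
    open ≡-Reasoning
    q = proj₁ (flatsRise u t)
    r = proj₂ (flatsRise u t)

flatsRise-parity : ∀ u t → let (q , r) = flatsRise u t in
  (parity q ≡ 0ℙ × suc r + t ≡ u) ⊎ (parity q ≡ 1ℙ × r + u ≡ t)
flatsRise-parity zero t = inj₂ (refl , +-identityʳ t)
flatsRise-parity (suc u) zero = inj₁ (refl , +-identityʳ (suc u))
flatsRise-parity (suc u) (suc t) with flatsRise-parity u t
... | inj₁ (even , eq) = inj₁ (even , trans (+-suc (suc (proj₂ (flatsRise u t))) t) (cong suc eq))
... | inj₂ (odd , eq) = inj₂ (odd , trans (+-suc (proj₂ (flatsRise u t)) u) (cong suc eq))

decode-OK : ∀ y w → Block.fall (decode y w) ≤ y × FlatsOnAxis y (Block.fall (decode y w)) (Block.flat (decode y w))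
decode-OK y (code τ u v) with v ≤? y
... | yes v≤y = v≤y , no-flats
... | no _ = ≤-refl , flatsRise-flats y u (v ∸ suc y)

decode-label : ∀ y w → Block.label (decode y w) ≡ Code.label w
decode-label y (code τ u v) with v ≤? y
... | yes _ = refl
... | no _ = refl

decode-size : ∀ y w → let (block _ p q r) = decode y w in r + (q + p) ≡ Code.u w + Code.v w
decode-size y (code τ u v) with v ≤? y
... | yes _ = refl
... | no v≰y = begin
  r + (q + y)        ≡⟨ sym (+-assoc r q y) ⟩
  r + q + y          ≡⟨ cong (_+ y) (flatsRise-size u t) ⟩
  suc (u + t) + y    ≡⟨ sym (+-suc (u + t) y) ⟩
  u + t + suc y      ≡⟨ +-assoc u t (suc y) ⟩
  u + (t + suc y)    ≡⟨ cong (u +_) (m∸n+n≡m (≰⇒> v≰y)) ⟩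
  u + v              ∎
  where
    open ≡-Reasoning
    t = v ∸ suc y
    q = proj₁ (flatsRise u t)
    r = proj₂ (flatsRise u t)

heightAfter-decode : ∀ y w → let c = decode y w ; h = heightAfter y c ; (code _ u v) = w in
  (parity (Block.flat c) ≡ 0ℙ × suc h + v ≡ suc y + u) ⊎ (parity (Block.flat c) ≡ 1ℙ × h + suc y + u ≡ v)
heightAfter-decode y (code τ u v) with v ≤? y
... | yes v≤y = inj₁ (refl , cong suc (begin
  u + (y ∸ v) + v    ≡⟨ +-assoc u (y ∸ v) v ⟩
  u + (y ∸ v + v)    ≡⟨ cong (u +_) (m∸n+n≡m v≤y) ⟩
  u + y              ≡⟨ +-comm u y ⟩
  y + u              ∎))
  where open ≡-Reasoning
... | no v≰y = Sum.map (map₂ even) (map₂ odd) (flatsRise-parity u t)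
  where
    open ≡-Reasoning
    t = v ∸ suc y
    r = proj₂ (flatsRise u t)
    h≡r : r + (y ∸ y) ≡ r
    h≡r = trans (cong (r +_) (n∸n≡0 y)) (+-identityʳ r)
    v≡ : t + suc y ≡ v
    v≡ = m∸n+n≡m (≰⇒> v≰y)

    even : suc r + t ≡ u → suc (r + (y ∸ y)) + v ≡ suc y + u
    even eq = begin
      suc (r + (y ∸ y)) + v    ≡⟨ cong (λ h → suc h + v) h≡r ⟩
      suc r + v                ≡⟨ cong (suc r +_) (sym v≡) ⟩
      suc r + (t + suc y)      ≡⟨ sym (+-assoc (suc r) t (suc y)) ⟩
      suc r + t + suc y        ≡⟨ cong (_+ suc y) eq ⟩
      u + suc y                ≡⟨ +-comm u (suc y) ⟩
      suc y + u                ∎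

    odd : r + u ≡ t → r + (y ∸ y) + suc y + u ≡ v
    odd eq = begin
      r + (y ∸ y) + suc y + u  ≡⟨ cong (λ h → h + suc y + u) h≡r ⟩
      r + suc y + u            ≡⟨ xy∙z≈xz∙y r (suc y) u ⟩
      r + u + suc y            ≡⟨ cong (_+ suc y) eq ⟩
      t + suc y                ≡⟨ v≡ ⟩
      v                        ∎

bit : Bool → ℕ
bit true = 1
bit false = 0

-- the least value of a part that may precede the given row
lowerBound : List OvPart → ℕ
lowerBound [] = 0
lowerBound ((x , overlined) ∷ _) = x + bit overlined

IsOverpartition-tail : ∀ p ps → IsOverpartition (p ∷ ps) → IsOverpartition ps
IsOverpartition-tail p [] _ = tt
IsOverpartition-tail p (q ∷ ps) (_ , ok) = ok

lowerBound-≤ : ∀ p ps → IsOverpartition (p ∷ ps) → lowerBound ps ≤ proj₁ p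
lowerBound-≤ p [] _ = z≤n
lowerBound-≤ p ((x , true) ∷ ps) (x<p , _) = subst (_≤ proj₁ p) (+-comm 1 x) x<p
lowerBound-≤ p ((x , false) ∷ ps) (x≤p , _) = subst (_≤ proj₁ p) (sym (+-identityʳ x)) x≤p

IsOverpartition-cons : ∀ α o ps → IsOverpartition ps → IsOverpartition ((α + lowerBound ps , o) ∷ ps)
IsOverpartition-cons α o [] _ = tt
IsOverpartition-cons α o ((x , true) ∷ ps) ok =
  subst (x <_) (sym (trans (cong (α +_) (+-comm x 1)) (+-suc α x))) (s≤s (m≤n+m x α)) , ok
IsOverpartition-cons α o ((x , false) ∷ ps) ok =
  subst (x ≤_) (sym (cong (α +_) (+-identityʳ x))) (m≤n+m x α) , ok

infix 4 _~_
record _~_ (x y : ℕ × ℕ) : Set where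
  constructor mk~
  field cross : proj₁ x + proj₂ y ≡ proj₁ y + proj₂ x

~-trans : ∀ {x y z} → x ~ y → y ~ z → x ~ z
~-trans {m , n} {p , q} {r , s} (mk~ x~y) (mk~ y~z) = mk~ (+-cancelʳ-≡ q (m + s) (r + n) (begin
  m + s + q   ≡⟨ xy∙z≈xz∙y m s q ⟩
  m + q + s   ≡⟨ cong (_+ s) x~y ⟩
  p + n + s   ≡⟨ xy∙z≈xz∙y p n s ⟩
  p + s + n   ≡⟨ cong (_+ n) y~z ⟩
  r + q + n   ≡⟨ xy∙z≈xz∙y r q n ⟩
  r + n + q   ∎))
  where open ≡-Reasoning

~-suc : ∀ m n → (suc m , suc n) ~ (m , n)
~-suc m n = mk~ (sym (+-suc m n))

~-shift : ∀ α β {m n p q} → (m , n) ~ (p , q) → (α + m , β + n) ~ (α + p , β + q)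
~-shift α β {m} {n} {p} {q} (mk~ eq) = mk~ (begin
  α + m + (β + q)   ≡⟨ solve (α ∷ β ∷ m ∷ q ∷ []) ⟩
  α + (m + q) + β   ≡⟨ cong (λ z → α + z + β) eq ⟩
  α + (p + n) + β   ≡⟨ solve (α ∷ β ∷ p ∷ n ∷ []) ⟩
  α + p + (β + n)   ∎)
  where open ≡-Reasoning

⊖-+-+ : ∀ m n c → m ⊖ n ≡ (m + c) ⊖ (n + c)
⊖-+-+ m n c = trans (sym (ℤₚ.+-cancelˡ-⊖ c m n)) (cong₂ _⊖_ (+-comm c m) (+-comm c n))

difference : ℕ × ℕ → ℤ
difference (m , n) = m ⊖ n

~⇒difference≡ : ∀ {x y} → x ~ y → difference x ≡ difference y
~⇒difference≡ {m , n} {p , q} (mk~ eq) = begin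
  m ⊖ n              ≡⟨ ⊖-+-+ m n q ⟩
  (m + q) ⊖ (n + q)  ≡⟨ cong (_⊖ (n + q)) eq ⟩
  (p + n) ⊖ (n + q)  ≡⟨ cong (_⊖ (n + q)) (+-comm p n) ⟩
  (n + p) ⊖ (n + q)  ≡⟨ ℤₚ.+-cancelˡ-⊖ n p q ⟩
  p ⊖ q              ∎
  where open ≡-Reasoning

⊖-cancelʳ-≤ : ∀ c {m n} → m ⊖ c ℤ.≤ n ⊖ c → m ≤ n
⊖-cancelʳ-≤ c {m} {n} le with m ≤? n
... | yes m≤n = m≤n
... | no m≰n = contradiction le (ℤₚ.<⇒≱ (ℤₚ.⊖-monoˡ-< c (≰⇒> m≰n)))

⊖≤⊖⇔ : ∀ m n p q → m ⊖ n ℤ.≤ p ⊖ q ⇔ m + q ≤ p + n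
⊖≤⊖⇔ m n p q = mk⇔
  (λ le → ⊖-cancelʳ-≤ (n + q) (subst₂ ℤ._≤_ (⊖-+-+ m n q) common le))
  (λ le → subst₂ ℤ._≤_ (sym (⊖-+-+ m n q)) (sym common) (ℤₚ.⊖-monoˡ-≤ (n + q) le))
  where
    common : p ⊖ q ≡ (p + n) ⊖ (n + q)
    common = trans (⊖-+-+ p q n) (cong ((p + n) ⊖_) (+-comm q n))

+-+-⊖ : ∀ x y m n → ((ℤ.+ x ℤ.- ℤ.+ y) ℤ.- ℤ.+ n) ℤ.+ ℤ.+ m ≡ (x + m) ⊖ (y + n)
+-+-⊖ x y m n = begin
  ((ℤ.+ x ℤ.- ℤ.+ y) ℤ.- ℤ.+ n) ℤ.+ ℤ.+ m  ≡⟨ regroup (ℤ.+ x) (ℤ.+ y) (ℤ.+ m) (ℤ.+ n) ⟩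
  (ℤ.+ x ℤ.+ ℤ.+ m) ℤ.- (ℤ.+ y ℤ.+ ℤ.+ n)  ≡⟨ cong₂ ℤ._-_ (sym (ℤₚ.pos-+ x m)) (sym (ℤₚ.pos-+ y n)) ⟩
  ℤ.+ (x + m) ℤ.- ℤ.+ (y + n)              ≡⟨ ℤₚ.[+m]-[+n]≡m⊖n (x + m) (y + n) ⟩
  (x + m) ⊖ (y + n)                        ∎
  where
    open ≡-Reasoning
    regroup : ∀ x y m n → ((x ℤ.- y) ℤ.- n) ℤ.+ m ≡ (x ℤ.+ m) ℤ.- (y ℤ.+ n)
    regroup = ℤSolver.solve-∀

InWindow : ℕ → ℕ → ℤ → Set
InWindow k i r = (ℤ.+ 2 ℤ.- ℤ.+ i) ℤ.≤ r × r ℤ.≤ (ℤ.+ (2 * k) ℤ.- ℤ.+ i ℤ.- ℤ.+ 1)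

lowerEnd≡ : ∀ i → ℤ.+ 2 ℤ.- ℤ.+ i ≡ 2 ⊖ i
lowerEnd≡ i = ℤₚ.[+m]-[+n]≡m⊖n 2 i

upperEnd≡ : ∀ k i → ℤ.+ (2 * k) ℤ.- ℤ.+ i ℤ.- ℤ.+ 1 ≡ (2 * k) ⊖ (i + 1)
upperEnd≡ k i = begin
  ℤ.+ (2 * k) ℤ.- ℤ.+ i ℤ.- ℤ.+ 1        ≡⟨ regroup (ℤ.+ (2 * k)) (ℤ.+ i) ⟩
  ℤ.+ (2 * k) ℤ.- (ℤ.+ i ℤ.+ ℤ.+ 1)      ≡⟨ cong (ℤ._-_ (ℤ.+ (2 * k))) (sym (ℤₚ.pos-+ i 1)) ⟩
  ℤ.+ (2 * k) ℤ.- ℤ.+ (i + 1)            ≡⟨ ℤₚ.[+m]-[+n]≡m⊖n (2 * k) (i + 1) ⟩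
  (2 * k) ⊖ (i + 1)                      ∎
  where
    open ≡-Reasoning
    regroup : ∀ x i → x ℤ.- i ℤ.- ℤ.+ 1 ≡ x ℤ.- (i ℤ.+ ℤ.+ 1)
    regroup = ℤSolver.solve-∀

-- The backward lists below are the reverses of paths started at height d.
module Backward (d : ℕ) where

  height : List Block → ℕ
  height [] = d
  height (c ∷ F) = heightAfter (height F) c

  Blocksʳ : ℕ → List Block → Set
  Blocksʳ k [] = ⊤
  Blocksʳ k (c ∷ F) = Blocksʳ k F × BlockOK k (height F) c

  xEnd : List Block → ℕ
  xEnd [] = 0
  xEnd (c ∷ F) = xAfter c (xEnd F)

  peakSum : (ℕ × Step → ℕ) → List Block → ℕ
  peakSum f [] = 0
  peakSum f (c ∷ F) = f (peakX c (xEnd F) , descent (Block.label c)) + peakSum f F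

  finalHeight-reverse : ∀ F → finalHeight d (reverse F) ≡ height F
  finalHeight-reverse [] = refl
  finalHeight-reverse (c ∷ F) = begin
    finalHeight d (reverse (c ∷ F))            ≡⟨ cong (finalHeight d) (List.unfold-reverse c F) ⟩
    finalHeight d (reverse F ++ c ∷ [])        ≡⟨ finalHeight-++ d (reverse F) (c ∷ []) ⟩
    heightAfter (finalHeight d (reverse F)) c  ≡⟨ cong (λ y → heightAfter y c) (finalHeight-reverse F) ⟩
    heightAfter (height F) c                   ∎
    where open ≡-Reasoning

  finalX-reverse : ∀ F → finalX 0 (reverse F) ≡ xEnd F
  finalX-reverse [] = refl
  finalX-reverse (c ∷ F) = begin
    finalX 0 (reverse (c ∷ F))       ≡⟨ cong (finalX 0) (List.unfold-reverse c F) ⟩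
    finalX 0 (reverse F ++ c ∷ [])   ≡⟨ finalX-++ 0 (reverse F) (c ∷ []) ⟩
    xAfter c (finalX 0 (reverse F))  ≡⟨ cong (xAfter c) (finalX-reverse F) ⟩
    xAfter c (xEnd F)                ∎
    where open ≡-Reasoning

  Blocks-reverse⁻ : ∀ {k} F → Blocks k d (reverse F) → Blocksʳ k F
  Blocks-reverse⁻ [] tt = tt
  Blocks-reverse⁻ (c ∷ F) ok
    with Blocks-++⁻ d (reverse F) (c ∷ []) (subst (Blocks _ d) (List.unfold-reverse c F) ok)
  ... | okF , (okc , tt) = Blocks-reverse⁻ F okF , subst (λ y → BlockOK _ y c) (finalHeight-reverse F) okc

  Blocks-reverse⁺ : ∀ {k} F → Blocksʳ k F → Blocks k d (reverse F)
  Blocks-reverse⁺ [] tt = tt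
  Blocks-reverse⁺ (c ∷ F) (okF , okc) = subst (Blocks _ d) (sym (List.unfold-reverse c F))
    (Blocks-++⁺ d (reverse F) (c ∷ []) (Blocks-reverse⁺ F okF)
      (subst (λ y → BlockOK _ y c) (sym (finalHeight-reverse F)) okc , tt))

  sum-blockPeaks-reverse : ∀ f F → sum (map f (blockPeaks 0 (reverse F))) ≡ peakSum f F
  sum-blockPeaks-reverse f [] = refl
  sum-blockPeaks-reverse f (c ∷ F) = begin
      sum (map f (blockPeaks 0 (reverse (c ∷ F))))
    ≡⟨ cong (λ L → sum (map f (blockPeaks 0 L))) (List.unfold-reverse c F) ⟩
      sum (map f (blockPeaks 0 (reverse F ++ c ∷ [])))
    ≡⟨ cong (λ ps → sum (map f ps)) (blockPeaks-++ 0 (reverse F) (c ∷ [])) ⟩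
      sum (map f (blockPeaks 0 (reverse F) ++ blockPeaks (finalX 0 (reverse F)) (c ∷ [])))
    ≡⟨ cong sum (List.map-++ f (blockPeaks 0 (reverse F)) _) ⟩
      sum (map f (blockPeaks 0 (reverse F)) ++ map f (blockPeaks (finalX 0 (reverse F)) (c ∷ [])))
    ≡⟨ sum-++ (map f (blockPeaks 0 (reverse F))) _ ⟩
      sum (map f (blockPeaks 0 (reverse F))) + (f (peakX c (finalX 0 (reverse F)) , _) + 0)
    ≡⟨ cong₂ _+_ (sum-blockPeaks-reverse f F)
         (trans (+-identityʳ _) (cong (λ x → f (peakX c x , _)) (finalX-reverse F))) ⟩
      peakSum f F + f (peakX c (xEnd F) , descent (Block.label c))
    ≡⟨ +-comm (peakSum f F) _ ⟩
      peakSum f (c ∷ F)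
    ∎ where open ≡-Reasoning

  State : Set
  State = ℕ × Parity

  step : State → Code → State
  step (y , s) w = heightAfter y (decode y w) , parity (Block.flat (decode y w)) ℙ.+ s

  state : List Code → State
  state [] = d , 0ℙ
  state (w ∷ ws) = step (state ws) w

  decodeAll : List Code → List Block
  decodeAll [] = []
  decodeAll (w ∷ ws) = decode (proj₁ (state ws)) w ∷ decodeAll ws

  encodeAll : List Block → List Code
  encodeAll [] = []
  encodeAll (c ∷ F) = encode (height F) c ∷ encodeAll F

  height-decodeAll : ∀ ws → height (decodeAll ws) ≡ proj₁ (state ws)
  height-decodeAll [] = refl
  height-decodeAll (w ∷ ws) = cong (λ y → heightAfter y (decode (proj₁ (state ws)) w)) (height-decodeAll ws)

  encodeAll-decodeAll : ∀ ws → encodeAll (decodeAll ws) ≡ ws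
  encodeAll-decodeAll [] = refl
  encodeAll-decodeAll (w ∷ ws) = cong₂ _∷_
    (trans (cong (λ y → encode y (decode (proj₁ (state ws)) w)) (height-decodeAll ws)) (encode-decode _ w))
    (encodeAll-decodeAll ws)

  decodeAll-encodeAll : ∀ {k} F → Blocksʳ k F → decodeAll (encodeAll F) ≡ F
  decodeAll-encodeAll [] tt = refl
  decodeAll-encodeAll (c ∷ F) (okF , (p≤y , flatsOK , _)) = cong₂ _∷_
    (trans (cong (λ y → decode y (encode (height F) c)) state≡) (decode-encode (height F) c p≤y flatsOK))
    IH
    where
      IH = decodeAll-encodeAll F okF
      state≡ : proj₁ (state (encodeAll F)) ≡ height F
      state≡ = trans (sym (height-decodeAll (encodeAll F))) (cong height IH)

  PeaksBelow : ℕ → List Code → Set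
  PeaksBelow k [] = ⊤
  PeaksBelow k (w ∷ ws) = PeaksBelow k ws × suc (proj₁ (state (w ∷ ws))) < k

  PeaksBelow⇒Blocksʳ : ∀ {k} ws → PeaksBelow k ws → Blocksʳ k (decodeAll ws)
  PeaksBelow⇒Blocksʳ [] tt = tt
  PeaksBelow⇒Blocksʳ {k} (w ∷ ws) (ok , lt) = PeaksBelow⇒Blocksʳ ws ok ,
    subst (λ y → BlockOK k y (decode (proj₁ (state ws)) w)) (sym (height-decodeAll ws))
      (proj₁ (decode-OK _ w) , proj₂ (decode-OK _ w) , lt)

  Blocksʳ⇒PeaksBelow : ∀ {k} F → Blocksʳ k F → PeaksBelow k (encodeAll F)
  Blocksʳ⇒PeaksBelow [] tt = tt
  Blocksʳ⇒PeaksBelow {k} (c@(block τ p q r) ∷ F) (okF , okc@(_ , _ , lt)) = Blocksʳ⇒PeaksBelow F okF ,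
    subst (λ y → suc y < k)
      (trans (cong height (sym (decodeAll-encodeAll (c ∷ F) (okF , okc)))) (height-decodeAll (encodeAll (c ∷ F)))) lt

  orient : Parity → ℕ × ℕ → ℕ × ℕ
  orient 0ℙ (u , v) = v , u
  orient 1ℙ (u , v) = u , v

  orient-involutive : ∀ s uv → orient s (orient s uv) ≡ uv
  orient-involutive 0ℙ uv = refl
  orient-involutive 1ℙ uv = refl

  orient-sum : ∀ s uv → let (α , β) = orient s uv in α + β ≡ proj₁ uv + proj₂ uv
  orient-sum 0ℙ (u , v) = +-comm v u
  orient-sum 1ℙ (u , v) = refl

  offsets : List Code → Code → ℕ × ℕ
  offsets ws (code _ u v) = orient (proj₂ (state ws)) (u , v)

  toArray : List Code → Array
  toArray [] = []
  toArray (w ∷ ws) =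
    ((proj₁ (offsets ws w) + lowerBound (top (toArray ws)) , proj₁ (Code.label w)) ,
     (proj₂ (offsets ws w) + lowerBound (bottom (toArray ws)) , proj₂ (Code.label w))) ∷ toArray ws

  fromArray : Array → List Code
  fromArray [] = []
  fromArray (((x , ox) , (y , oy)) ∷ cs) =
    let (u , v) = orient (proj₂ (state (fromArray cs))) (x ∸ lowerBound (top cs) , y ∸ lowerBound (bottom cs))
    in code (ox , oy) u v ∷ fromArray cs

  fromArray-toArray : ∀ ws → fromArray (toArray ws) ≡ ws
  fromArray-toArray [] = refl
  fromArray-toArray (code τ u v ∷ ws)
    rewrite fromArray-toArray ws
          | m+n∸n≡m (proj₁ (offsets ws (code τ u v))) (lowerBound (top (toArray ws)))
          | m+n∸n≡m (proj₂ (offsets ws (code τ u v))) (lowerBound (bottom (toArray ws)))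
          | orient-involutive (proj₂ (state ws)) (u , v) = refl

  toArray-fromArray : ∀ cs → IsOverpartition (top cs) → IsOverpartition (bottom cs) → toArray (fromArray cs) ≡ cs
  toArray-fromArray [] _ _ = refl
  toArray-fromArray (((x , ox) , (y , oy)) ∷ cs) okT okB
    rewrite orient-involutive (proj₂ (state (fromArray cs))) (x ∸ lowerBound (top cs) , y ∸ lowerBound (bottom cs))
          | toArray-fromArray cs (IsOverpartition-tail _ _ okT) (IsOverpartition-tail _ _ okB)
          | m∸n+n≡m (lowerBound-≤ (x , ox) (top cs) okT)
          | m∸n+n≡m (lowerBound-≤ (y , oy) (bottom cs) okB) = refl

  toArray-top : ∀ ws → IsOverpartition (top (toArray ws))
  toArray-top [] = tt
  toArray-top (w ∷ ws) = IsOverpartition-cons _ _ _ (toArray-top ws)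

  toArray-bottom : ∀ ws → IsOverpartition (bottom (toArray ws))
  toArray-bottom [] = tt
  toArray-bottom (w ∷ ws) = IsOverpartition-cons _ _ _ (toArray-bottom ws)

  -- the rank d - y in even and d + 1 + y in odd orientation, as a formal difference
  rankPair : State → ℕ × ℕ
  rankPair (y , 0ℙ) = d , y
  rankPair (y , 1ℙ) = d + suc y , 0

  rankPair-next : ∀ y s u v h f → (f ≡ 0ℙ × suc h + v ≡ suc y + u) ⊎ (f ≡ 1ℙ × h + suc y + u ≡ v) →
                  let (α , β) = orient s (u , v) ; (m , n) = rankPair (y , s) in
                  (α + m , β + n) ~ rankPair (h , f ℙ.+ s)
  rankPair-next y 0ℙ u v h _ (inj₁ (refl , eq)) = mk~ (suc-injective (begin
    suc (v + d + h)     ≡⟨ solve (v ∷ d ∷ h ∷ []) ⟩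
    d + (suc h + v)     ≡⟨ cong (d +_) eq ⟩
    d + (suc y + u)     ≡⟨ solve (d ∷ y ∷ u ∷ []) ⟩
    suc (d + (u + y))   ∎))
    where open ≡-Reasoning
  rankPair-next y 0ℙ u v h _ (inj₂ (refl , eq)) = mk~ (begin
    v + d + 0                  ≡⟨ cong (λ v → v + d + 0) (sym eq) ⟩
    h + suc y + u + d + 0      ≡⟨ solve (h ∷ y ∷ u ∷ d ∷ []) ⟩
    d + suc h + (u + y)        ∎)
    where open ≡-Reasoning
  rankPair-next y 1ℙ u v h _ (inj₁ (refl , eq)) = mk~ (begin
    u + (d + suc y) + 0   ≡⟨ solve (u ∷ d ∷ y ∷ []) ⟩
    d + (suc y + u)       ≡⟨ cong (d +_) (sym eq) ⟩
    d + (suc h + v)       ≡⟨ solve (d ∷ h ∷ v ∷ []) ⟩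
    d + suc h + (v + 0)   ∎)
    where open ≡-Reasoning
  rankPair-next y 1ℙ u v h _ (inj₂ (refl , eq)) = mk~ (begin
    u + (d + suc y) + h   ≡⟨ solve (u ∷ d ∷ y ∷ h ∷ []) ⟩
    d + (h + suc y + u)   ≡⟨ cong (d +_) eq ⟩
    d + v                 ≡⟨ cong (d +_) (sym (+-identityʳ v)) ⟩
    d + (v + 0)           ∎)
    where open ≡-Reasoning

  balance : List Code → ℕ × ℕ
  balance ws = let cs = toArray ws in
    lowerBound (top cs) + countNonOv (top cs) , lowerBound (bottom cs) + countNonOv (bottom cs)

  column~ : ∀ w ws → balance ws ~ rankPair (state ws) →
            let (α , β) = offsets ws w ; (m , n) = balance ws in (α + m , β + n) ~ rankPair (state (w ∷ ws))
  column~ w ws bal = ~-trans (~-shift _ _ bal)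
    (rankPair-next (proj₁ (state ws)) (proj₂ (state ws)) _ _ _ _ (heightAfter-decode (proj₁ (state ws)) w))

  balance~ : ∀ ws → balance ws ~ rankPair (state ws)
  balance~ [] = mk~ (+-comm 0 d)
  balance~ (w ∷ ws) = subst₂ (λ m n → (m , n) ~ rankPair (state (w ∷ ws)))
    (sym (grow (proj₁ (offsets ws w)) _ _ (proj₁ (Code.label w))))
    (sym (grow (proj₂ (offsets ws w)) _ _ (proj₂ (Code.label w))))
    (~-trans (~-suc _ _) (column~ w ws (balance~ ws)))
    where
      grow : ∀ α m n o → α + m + bit o + (nonOv (α + m , o) + n) ≡ suc (α + (m + n))
      grow α m n true = solve (α ∷ m ∷ n ∷ [])
      grow α m n false = solve (α ∷ m ∷ n ∷ [])

  rank : State → ℤ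
  rank st = difference (rankPair st)

  successiveRanks-toArray : ∀ w ws → successiveRanks (toArray (w ∷ ws)) ≡ rank (state (w ∷ ws)) ∷ successiveRanks (toArray ws)
  successiveRanks-toArray w ws = cong (_∷ _) (trans (+-+-⊖ (α + lt) (β + lb) ct cb)
    (~⇒difference≡ (subst₂ (λ m n → (m , n) ~ rankPair (state (w ∷ ws))) (sym (+-assoc α lt ct)) (sym (+-assoc β lb cb)) (column~ w ws (balance~ ws)))))
    where
      cs = toArray ws
      α = proj₁ (offsets ws w)
      β = proj₂ (offsets ws w)
      lt = lowerBound (top cs)
      lb = lowerBound (bottom cs)
      ct = countNonOv (top cs)
      cb = countNonOv (bottom cs)

  rank-inWindow : ∀ {k i} → k ≡ d + i → 1 ≤ i → ∀ st → InWindow k i (rank st) ⇔ suc (proj₁ st) < k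
  rank-inWindow {i = i} refl 1≤i (y , 0ℙ) = mk⇔
    (λ (lo , _) → Equivalence.to (⊖≤⊖⇔ 2 i d y) (subst (ℤ._≤ d ⊖ y) (lowerEnd≡ i) lo))
    (λ lt → subst (ℤ._≤ d ⊖ y) (sym (lowerEnd≡ i)) (Equivalence.from (⊖≤⊖⇔ 2 i d y) lt) ,
            subst (d ⊖ y ℤ.≤_) (sym (upperEnd≡ (d + i) i)) (Equivalence.from (⊖≤⊖⇔ d y _ _) (upper lt)))
    where
      upper : suc y < d + i → d + (i + 1) ≤ 2 * (d + i) + y
      upper lt = begin
        d + (i + 1)          ≡⟨ solve (d ∷ i ∷ []) ⟩
        (d + i) + 1          ≤⟨ +-monoʳ-≤ (d + i) (≤-trans (s≤s z≤n) lt) ⟩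
        (d + i) + (d + i)    ≡⟨ solve (d ∷ i ∷ []) ⟩
        2 * (d + i)          ≤⟨ m≤m+n (2 * (d + i)) y ⟩
        2 * (d + i) + y      ∎
        where open ≤-Reasoning
  rank-inWindow {i = i} refl 1≤i (y , 1ℙ) = mk⇔
    (λ (_ , hi) → +-cancelˡ-≤ (d + i) _ _ (subst₂ _≤_ (sym shift) (sym double)
       (Equivalence.to (⊖≤⊖⇔ (d + suc y) 0 (2 * (d + i)) (i + 1)) (subst (_ ℤ.≤_) (upperEnd≡ (d + i) i) hi))))
    (λ lt → subst (ℤ._≤ _) (sym (lowerEnd≡ i)) (Equivalence.from (⊖≤⊖⇔ 2 i (d + suc y) 0) (lower)) ,
            subst (_ ℤ.≤_) (sym (upperEnd≡ (d + i) i)) (Equivalence.from (⊖≤⊖⇔ (d + suc y) 0 (2 * (d + i)) (i + 1))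
              (subst₂ _≤_ shift double (+-monoʳ-≤ (d + i) lt))))
    where
      shift : d + i + suc (suc y) ≡ d + suc y + (i + 1)
      shift = solve (d ∷ i ∷ y ∷ [])
      double : d + i + (d + i) ≡ 2 * (d + i) + 0
      double = solve (d ∷ i ∷ [])
      lower : 2 + 0 ≤ d + suc y + i
      lower = begin
        2 + 0                ≤⟨ s≤s 1≤i ⟩
        suc i                ≤⟨ m≤m+n (suc i) (d + y) ⟩
        suc i + (d + y)      ≡⟨ solve (d ∷ i ∷ y ∷ []) ⟩
        d + suc y + i        ∎
        where open ≤-Reasoning

  PeaksBelow⇔inWindow : ∀ {k i} → k ≡ d + i → 1 ≤ i →
    ∀ ws → PeaksBelow k ws ⇔ All (InWindow k i) (successiveRanks (toArray ws))
  PeaksBelow⇔inWindow {k} {i} k≡ 1≤i ws = mk⇔ (to ws) (from ws)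
    where
      to : ∀ ws → PeaksBelow k ws → All (InWindow k i) (successiveRanks (toArray ws))
      to [] tt = All.[]
      to (w ∷ ws) (ok , lt) = subst (All (InWindow k i)) (sym (successiveRanks-toArray w ws))
        (Equivalence.from (rank-inWindow k≡ 1≤i (state (w ∷ ws))) lt All.∷ to ws ok)

      from : ∀ ws → All (InWindow k i) (successiveRanks (toArray ws)) → PeaksBelow k ws
      from [] _ = tt
      from (w ∷ ws) inWindow with subst (All (InWindow k i)) (successiveRanks-toArray w ws) inWindow
      ... | r All.∷ rs = from ws rs , Equivalence.to (rank-inWindow k≡ 1≤i (state (w ∷ ws))) r

  xAfter-descent : ∀ τ m → moveX (suc m) (descent τ) ≡ m + (bit (proj₁ τ) + bit (proj₂ τ))
  xAfter-descent (true , true) m = +-comm 2 m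
  xAfter-descent (true , false) m = +-comm 1 m
  xAfter-descent (false , true) m = +-comm 1 m
  xAfter-descent (false , false) m = sym (+-identityʳ m)

  module _ (ws : List Code) (w : Code) where
    private
      cs = toArray ws
      y = proj₁ (state ws)
      c = decode y w

    peakX-decode : peakX c (lowerBound (top cs) + lowerBound (bottom cs)) ≡
                   suc ((proj₁ (offsets ws w) + lowerBound (top cs)) + (proj₂ (offsets ws w) + lowerBound (bottom cs)))
    peakX-decode = cong suc (begin
      r + (q + (p + (lt + lb)))    ≡⟨ cong (r +_) (sym (+-assoc q p (lt + lb))) ⟩
      r + (q + p + (lt + lb))      ≡⟨ sym (+-assoc r (q + p) (lt + lb)) ⟩
      (r + (q + p)) + (lt + lb)    ≡⟨ cong (_+ (lt + lb)) (decode-size y w) ⟩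
      (u + v) + (lt + lb)          ≡⟨ cong (_+ (lt + lb)) (sym (orient-sum (proj₂ (state ws)) (u , v))) ⟩
      (α + β) + (lt + lb)          ≡⟨ interchange α β lt lb ⟩
      (α + lt) + (β + lb)          ∎)
      where
        open ≡-Reasoning
        p = Block.fall c
        q = Block.flat c
        r = Block.rise c
        u = Code.u w
        v = Code.v w
        α = proj₁ (offsets ws w)
        β = proj₂ (offsets ws w)
        lt = lowerBound (top cs)
        lb = lowerBound (bottom cs)

  xEnd-decodeAll : ∀ ws → xEnd (decodeAll ws) ≡ lowerBound (top (toArray ws)) + lowerBound (bottom (toArray ws))
  xEnd-decodeAll [] = refl
  xEnd-decodeAll (w ∷ ws) = begin
    moveX (peakX c (xEnd (decodeAll ws))) (descent (Block.label c))
      ≡⟨ cong₂ (λ x τ → moveX (peakX c x) (descent τ)) (xEnd-decodeAll ws) (decode-label _ w) ⟩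
    moveX (peakX c (lt + lb)) (descent τ)
      ≡⟨ cong (λ x → moveX x (descent τ)) (peakX-decode ws w) ⟩
    moveX (suc ((α + lt) + (β + lb))) (descent τ)
      ≡⟨ xAfter-descent τ _ ⟩
    (α + lt) + (β + lb) + (bit (proj₁ τ) + bit (proj₂ τ))
      ≡⟨ interchange (α + lt) (β + lb) (bit (proj₁ τ)) (bit (proj₂ τ)) ⟩
    (α + lt + bit (proj₁ τ)) + (β + lb + bit (proj₂ τ))
      ∎
    where
      open ≡-Reasoning
      c = decode (proj₁ (state ws)) w
      τ = Code.label w
      α = proj₁ (offsets ws w)
      β = proj₂ (offsets ws w)
      lt = lowerBound (top (toArray ws))
      lb = lowerBound (bottom (toArray ws))

  weight-toArray : ∀ ws → weight (toArray ws) ≡ peakSum proj₁ (decodeAll ws)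
  weight-toArray [] = refl
  weight-toArray (w ∷ ws) = trans (weight-∷ (α + lowerBound (top cs) , proj₁ τ) (β + lowerBound (bottom cs) , proj₂ τ) cs)
    (cong₂ _+_ (sym (trans (cong (peakX (decode (proj₁ (state ws)) w)) (xEnd-decodeAll ws)) (peakX-decode ws w)))
      (weight-toArray ws))
    where
      cs = toArray ws
      τ = Code.label w
      α = proj₁ (offsets ws w)
      β = proj₂ (offsets ws w)
      weight-∷ : ∀ p q cs → weight ((p , q) ∷ cs) ≡ suc (proj₁ p + proj₁ q) + weight cs
      weight-∷ p q cs = cong suc (x∙yz≈y∙xz (length cs) (proj₁ p + proj₁ q) _)

  countNonOv-bottom : ∀ ws → countNonOv (bottom (toArray ws)) ≡ peakSum (λ p → markA (proj₂ p)) (decodeAll ws)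
  countNonOv-bottom [] = refl
  countNonOv-bottom (w ∷ ws) = cong₂ _+_
    (sym (trans (cong (markA ∘ descent) (decode-label _ w)) (markA-descent (Code.label w))))
    (countNonOv-bottom ws)
    where
      markA-descent : ∀ τ {x} → markA (descent τ) ≡ nonOv (x , proj₂ τ)
      markA-descent (true , true) = refl
      markA-descent (true , false) = refl
      markA-descent (false , true) = refl
      markA-descent (false , false) = refl

  countNonOv-top : ∀ ws → countNonOv (top (toArray ws)) ≡ peakSum (λ p → markB (proj₂ p)) (decodeAll ws)
  countNonOv-top [] = refl
  countNonOv-top (w ∷ ws) = cong₂ _+_
    (sym (trans (cong (markB ∘ descent) (decode-label _ w)) (markB-descent (Code.label w))))
    (countNonOv-top ws)
    where
      markB-descent : ∀ τ {x} → markB (descent τ) ≡ nonOv (x , proj₁ τ)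
      markB-descent (true , true) = refl
      markB-descent (true , false) = refl
      markB-descent (false , true) = refl
      markB-descent (false , false) = refl

  length-toArray : ∀ ws → length (toArray ws) ≡ length ws
  length-toArray [] = refl
  length-toArray (w ∷ ws) = cong suc (length-toArray ws)

  length-encodeAll : ∀ F → length (encodeAll F) ≡ length F
  length-encodeAll [] = refl
  length-encodeAll (c ∷ F) = cong suc (length-encodeAll F)

  sum-peaks-render : ∀ f F → sum (map f (peaks (render d (reverse F)))) ≡ peakSum f F
  sum-peaks-render f F = trans (cong (sum ∘ map f) (peakList-render 0 d (reverse F))) (sum-blockPeaks-reverse f F)

ValidFrom-irrelevant : ∀ {k} x y prev ss (u v : ValidFrom k x y prev ss) → u ≡ v
ValidFrom-irrelevant x y prev [] (u₁ , u₂) (v₁ , v₂) = cong₂ _,_ (≤-irrelevant u₁ v₁) (uip u₂ v₂)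
ValidFrom-irrelevant x y prev (s ∷ ss) (u₁ , u₂ , u₃ , u₄) (v₁ , v₂ , v₃ , v₄) =
  cong₂ _,_ (≤-irrelevant u₁ v₁) (cong₂ _,_ (StepOK-irrelevant s u₂ v₂)
    (cong₂ _,_ (MayContinue-irrelevant y u₃ v₃) (ValidFrom-irrelevant _ _ _ ss u₄ v₄)))
  where
    StepOK-irrelevant : ∀ s (u v : StepOK x y prev s) → u ≡ v
    StepOK-irrelevant NE tt tt = refl
    StepOK-irrelevant SE u v = ≤-irrelevant u v
    StepOK-irrelevant (S l) (u₁ , u₂) (v₁ , v₂) = cong₂ _,_ (uip u₁ v₁) (≤-irrelevant u₂ v₂)
    StepOK-irrelevant SW (u₁ , u₂ , u₃) (v₁ , v₂ , v₃) =
      cong₂ _,_ (uip u₁ v₁) (cong₂ _,_ (≤-irrelevant u₂ v₂) (≤-irrelevant u₃ v₃))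
    StepOK-irrelevant E u v = uip u v

    MayContinue-irrelevant : ∀ y (u v : MayContinue y (s ∷ ss)) → u ≡ v
    MayContinue-irrelevant zero u v = ≤-irrelevant u v
    MayContinue-irrelevant (suc y) tt tt = refl

IsOverpartition-irrelevant : ∀ ps (u v : IsOverpartition ps) → u ≡ v
IsOverpartition-irrelevant [] tt tt = refl
IsOverpartition-irrelevant (p ∷ []) tt tt = refl
IsOverpartition-irrelevant (p ∷ (x , true) ∷ ps) (u₁ , u₂) (v₁ , v₂) =
  cong₂ _,_ (≤-irrelevant u₁ v₁) (IsOverpartition-irrelevant _ u₂ v₂)
IsOverpartition-irrelevant (p ∷ (x , false) ∷ ps) (u₁ , u₂) (v₁ , v₂) =
  cong₂ _,_ (≤-irrelevant u₁ v₁) (IsOverpartition-irrelevant _ u₂ v₂)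

Σ-≡ : ∀ {A : Set} {B : A → Set} → (∀ {x} (u v : B x) → u ≡ v) → {p q : Σ A B} → proj₁ p ≡ proj₁ q → p ≡ q
Σ-≡ irrelevant {x , u} {.x , v} refl = cong (x ,_) (irrelevant u v)

module Correspondence (k i s t n : ℕ) (1≤i : 1 ≤ i) (i≤k : i ≤ k) where

  d : ℕ
  d = k ∸ i

  open Backward d

  k≡d+i : k ≡ d + i
  k≡d+i = sym (m∸n+n≡m i≤k)

  d<k : d < k
  d<k = subst (d <_) (sym k≡d+i) (m<m+n d 1≤i)

  blocksOf : BBPath k i s t n → List Block
  blocksOf (ss , valid , _) = reverse (proj₁ (parse 0 d ss valid))

  blocksOf-OK : ∀ p → Blocksʳ k (blocksOf p)
  blocksOf-OK (ss , valid , _) = let (L , ok , _) = parse 0 d ss valid in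
    Blocks-reverse⁻ (reverse L) (subst (Blocks k d) (sym (List.reverse-involutive L)) ok)

  render-blocksOf : ∀ p → render d (reverse (blocksOf p)) ≡ proj₁ p
  render-blocksOf (ss , valid , _) = let (L , _ , render≡) = parse 0 d ss valid in
    trans (cong (render d) (List.reverse-involutive L)) render≡

  toFrob : BBPath k i s t n → FrobRep k i s t n
  toFrob p@(ss , _ , major≡ , markedA≡ , markedB≡) =
    toArray ws , toArray-top ws , toArray-bottom ws ,
    trans (weight-toArray ws) (trans (statistic proj₁) major≡) ,
    trans (countNonOv-bottom ws) (trans (statistic _) markedA≡) ,
    trans (countNonOv-top ws) (trans (statistic _) markedB≡) ,
    Equivalence.to (PeaksBelow⇔inWindow k≡d+i 1≤i ws) (Blocksʳ⇒PeaksBelow F (blocksOf-OK p))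
    where
      F = blocksOf p
      ws = encodeAll F
      statistic : ∀ f → peakSum f (decodeAll ws) ≡ sum (map f (peaks ss))
      statistic f = trans (cong (peakSum f) (decodeAll-encodeAll F (blocksOf-OK p)))
        (trans (sym (sum-peaks-render f F)) (cong (sum ∘ map f ∘ peaks) (render-blocksOf p)))

  fromFrob : FrobRep k i s t n → BBPath k i s t n
  fromFrob (cs , topOK , bottomOK , weight≡ , bottom≡ , top≡ , ranks) =
    render d (reverse F) , render-valid d (reverse F) d<k (Blocks-reverse⁺ F OK) 0 ,
    trans (sum-peaks-render proj₁ F) (trans (sym (weight-toArray ws)) (trans (cong weight toArray≡) weight≡)) ,
    trans (sum-peaks-render _ F) (trans (sym (countNonOv-bottom ws)) (trans (cong (countNonOv ∘ bottom) toArray≡) bottom≡)) ,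
    trans (sum-peaks-render _ F) (trans (sym (countNonOv-top ws)) (trans (cong (countNonOv ∘ top) toArray≡) top≡))
    where
      ws = fromArray cs
      F = decodeAll ws
      toArray≡ = toArray-fromArray cs topOK bottomOK
      OK : Blocksʳ k F
      OK = PeaksBelow⇒Blocksʳ ws (Equivalence.from (PeaksBelow⇔inWindow k≡d+i 1≤i ws)
        (subst (All (InWindow k i) ∘ successiveRanks) (sym toArray≡) ranks))

  blocksOf-unique : ∀ p F → render d (reverse F) ≡ proj₁ p → blocksOf p ≡ F
  blocksOf-unique p F render≡ = List.reverse-injective
    (render-injective d _ _ (trans (render-blocksOf p) (sym render≡)))

  BBPath-irrelevant : ∀ {ss} (u v : ValidFrom k 0 d false ss × majorIndex ss ≡ n × markedA ss ≡ s × markedB ss ≡ t) → u ≡ v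
  BBPath-irrelevant (valid , eqs) (valid′ , eqs′) =
    cong₂ _,_ (ValidFrom-irrelevant _ _ _ _ valid valid′) (cong₂ _,_ (uip _ _) (cong₂ _,_ (uip _ _) (uip _ _)))

  FrobRep-irrelevant : ∀ {cs} (u v : IsOverpartition (top cs) × IsOverpartition (bottom cs) × weight cs ≡ n ×
                          countNonOv (bottom cs) ≡ s × countNonOv (top cs) ≡ t × All (InWindow k i) (successiveRanks cs)) → u ≡ v
  FrobRep-irrelevant {cs} (top₁ , bottom₁ , _ , _ , _ , ranks₁) (top₂ , bottom₂ , _ , _ , _ , ranks₂) =
    cong₂ _,_ (IsOverpartition-irrelevant _ top₁ top₂) (cong₂ _,_ (IsOverpartition-irrelevant _ bottom₁ bottom₂)
      (cong₂ _,_ (uip _ _) (cong₂ _,_ (uip _ _) (cong₂ _,_ (uip _ _) (All.irrelevant InWindow-irrelevant ranks₁ ranks₂)))))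
    where
      InWindow-irrelevant : ∀ {r} (u v : InWindow k i r) → u ≡ v
      InWindow-irrelevant (lo₁ , hi₁) (lo₂ , hi₂) = cong₂ _,_ (ℤₚ.≤-irrelevant lo₁ lo₂) (ℤₚ.≤-irrelevant hi₁ hi₂)

  fromFrob-toFrob : ∀ p → fromFrob (toFrob p) ≡ p
  fromFrob-toFrob p = Σ-≡ BBPath-irrelevant (begin
    render d (reverse (decodeAll (fromArray (toArray (encodeAll F)))))
      ≡⟨ cong (render d ∘ reverse ∘ decodeAll) (fromArray-toArray (encodeAll F)) ⟩
    render d (reverse (decodeAll (encodeAll F)))
      ≡⟨ cong (render d ∘ reverse) (decodeAll-encodeAll F (blocksOf-OK p)) ⟩
    render d (reverse F)
      ≡⟨ render-blocksOf p ⟩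
    proj₁ p
      ∎)
    where
      open ≡-Reasoning
      F = blocksOf p

  toFrob-fromFrob : ∀ f → toFrob (fromFrob f) ≡ f
  toFrob-fromFrob f@(cs , topOK , bottomOK , _) = Σ-≡ FrobRep-irrelevant (begin
    toArray (encodeAll (blocksOf (fromFrob f)))
      ≡⟨ cong (toArray ∘ encodeAll) (blocksOf-unique (fromFrob f) (decodeAll ws) refl) ⟩
    toArray (encodeAll (decodeAll ws))
      ≡⟨ cong toArray (encodeAll-decodeAll ws) ⟩
    toArray ws
      ≡⟨ toArray-fromArray cs topOK bottomOK ⟩
    cs
      ∎)
    where
      open ≡-Reasoning
      ws = fromArray cs

  numPeaks≡columns : ∀ p → numPeaks (proj₁ p) ≡ columns (proj₁ (toFrob p))
  numPeaks≡columns p = begin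
    length (peaks (proj₁ p))                    ≡⟨ cong (length ∘ peaks) (sym (render-blocksOf p)) ⟩
    length (peaks (render d (reverse F)))       ≡⟨ cong length (peakList-render 0 d (reverse F)) ⟩
    length (blockPeaks 0 (reverse F))           ≡⟨ length-blockPeaks 0 (reverse F) ⟩
    length (reverse F)                          ≡⟨ List.length-reverse F ⟩
    length F                                    ≡⟨ sym (length-encodeAll F) ⟩
    length (encodeAll F)                        ≡⟨ sym (length-toArray (encodeAll F)) ⟩
    length (toArray (encodeAll F))              ∎
    where
      open ≡-Reasoning
      F = blocksOf p

proposition4 : (k i s t n : ℕ) → 2 ≤ k → 1 ≤ i → i ≤ k →
    Σ (BBPath k i s t n ⤖ FrobRep k i s t n) λ f →
    (p : BBPath k i s t n) →
    numPeaks (proj₁ p) ≡ columns (proj₁ (Bijection.to f p))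
-- The construction does not need k ≥ 2.
proposition4 k i s t n _ 1≤i i≤k =
  ↔⇒⤖ (mk↔ₛ′ toFrob fromFrob toFrob-fromFrob fromFrob-toFrob) , numPeaks≡columns
  where open Correspondence k i s t n 1≤i i≤k
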